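{- Let $\mathbf{D}_{2n} = \langle x, y \mid x^n = y^2 = 1,\ x^{ -1}y = yx\rangle$ be the dihedral group of order $2n$ and $\mathbf{Q}_{4n} = \langle x, y \mid x^n = y^2,\ x^{2n} = 1,\ x^{ -1}y = yx\rangle$ the dicyclic group of order $4n$. (a) For every integer $n \ge 3$, $f(\mathbf{D}_{2n}) = e(\mathbf{D}_{2n}) = d(\mathbf{D}_{2n}) - 1 = n$. (b) For every integer $n \ge 2$, $f(\mathbf{Q}_{4n}) = e(\mathbf{Q}_{4n}) = d(\mathbf{Q}_{4n}) - 1 = 2n$.
   Context: Let $G$ be a finite group (written multiplicatively). A sequence in $G$ is a tuple $S=(a_1,\dots,a_n)$ of elements of $G$ (repetition allowed); a subsequence is obtained by choosing a nonempty subset of the index set. $\Pi(S)$ denotes the set of all products $a_{\sigma(1)}\cdots a_{\sigma(n)}$, $\sigma$ ranging over all permutations of $\{1,\dots,n\}$. $S$ is a product-one sequence if $1\in\Pi(S)$. The Davenport constant $d(G)$ is the smallest positive integer $m$ such that every sequence in $G$ of length $m$ has a product-one subsequence. $f(G)$ is the smallest positive integer $m$ such that every sequence in $G$ of length $d(G)$ has a product-one subsequence of length at most $m$. $e(G)$ is the smallest positive integer $m$ such that every product-one sequence in $G$ has a product-one subsequence of length at most $m$. -}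

module Defs where

open import Level using (Level)
open import Data.Nat using (ℕ; zero; suc; _+_; _*_; _∸_; _≤_; NonZero)
open import Data.Nat.Properties using (m*n≢0)
open import Data.Nat.DivMod using (_mod_)
open import Data.Fin using (Fin; toℕ)
open import Data.Bool using (Bool; true; false; _xor_; _∧_; if_then_else_)
open import Data.Product using (_×_; _,_; Σ; ∃)
open import Data.List using (List; []; length; foldr)
open import Data.List.Relation.Binary.Permutation.Propositional using (_↭_)
open import Data.List.Relation.Binary.Sublist.Propositional using (_⊆_)
open import Relation.Binary.PropositionalEquality using (_≡_; _≢_)
open import Algebra.Bundles.Raw using (RawMonoid)

module _ {c ℓ : Level} (G : RawMonoid c ℓ) where
  open RawMonoid G

  prod : List Carrier → Carrier
  prod = foldr _∙_ ε

  ProductOne : List Carrier → Set (c Level.⊔ ℓ)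
  ProductOne S = ∃ λ T → (T ↭ S) × (prod T ≈ ε)

  -- S has a (nonempty) product-one subsequence of length at most m
  -- (a subsequence = the terms at a nonempty set of indices = a sublist)
  HasPOSubseqLen≤ : List Carrier → ℕ → Set (c Level.⊔ ℓ)
  HasPOSubseqLen≤ S m =
    ∃ λ T → (T ⊆ S) × (1 ≤ length T) × (length T ≤ m) × ProductOne T

  HasPOSubseq : List Carrier → Set (c Level.⊔ ℓ)
  HasPOSubseq S = ∃ λ T → (T ⊆ S) × (1 ≤ length T) × ProductOne T

  DavenportProp : ℕ → Set (c Level.⊔ ℓ)
  DavenportProp m = ∀ (S : List Carrier) → length S ≡ m → HasPOSubseq S

  FProp : ℕ → ℕ → Set (c Level.⊔ ℓ)
  FProp d m = ∀ (S : List Carrier) → length S ≡ d → HasPOSubseqLen≤ S m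

  -- property defining e(G)  (product-one sequences are nonempty)
  EProp : ℕ → Set (c Level.⊔ ℓ)
  EProp m = ∀ (S : List Carrier) → S ≢ [] → ProductOne S → HasPOSubseqLen≤ S m

IsLeastPos : {p : Level} → (ℕ → Set p) → ℕ → Set p
IsLeastPos P m = (1 ≤ m) × P m × (∀ k → 1 ≤ k → P k → m ≤ k)

DavenportIs : {c ℓ : Level} → RawMonoid c ℓ → ℕ → Set _
DavenportIs G m = IsLeastPos (DavenportProp G) m

FIs : {c ℓ : Level} → RawMonoid c ℓ → ℕ → Set _
FIs G m = ∃ λ d → DavenportIs G d × IsLeastPos (FProp G d) m

EIs : {c ℓ : Level} → RawMonoid c ℓ → ℕ → Set _
EIs G m = IsLeastPos (EProp G) m

-- Concrete models.  The element (i , b) stands for x^i y^b.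

-- Dihedral group D_{2n} = ⟨x,y | xⁿ = y² = 1, x⁻¹y = yx⟩:
--   x^i y^a · x^j y^b = x^{i + (-1)^a j} y^{a+b}
dihMul : (n : ℕ) .{{_ : NonZero n}} → Fin n × Bool → Fin n × Bool → Fin n × Bool
dihMul n (i , a) (j , b) =
  ((toℕ i + (if a then n ∸ toℕ j else toℕ j)) mod n , a xor b)

Dihedral : (n : ℕ) .{{_ : NonZero n}} → RawMonoid _ _
Dihedral n = record
  { Carrier = Fin n × Bool
  ; _≈_     = _≡_
  ; _∙_     = dihMul n
  ; ε       = (0 mod n , false)
  }

-- Dicyclic group Q_{4n} = ⟨x,y | xⁿ = y², x^{2n} = 1, x⁻¹y = yx⟩:
--   x^i y^a · x^j y^b = x^{i + (-1)^a j + [a ∧ b] n} y^{a+b}, exponents mod 2n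
dicMul : (n : ℕ) .{{_ : NonZero n}} →
         Fin (2 * n) × Bool → Fin (2 * n) × Bool → Fin (2 * n) × Bool
dicMul n (i , a) (j , b) =
  ((toℕ i + (if a then 2 * n ∸ toℕ j else toℕ j) + (if a ∧ b then n else 0))
     mod (2 * n)
  , a xor b)
  where instance _ = m*n≢0 2 n

Dicyclic : (n : ℕ) .{{_ : NonZero n}} → RawMonoid _ _
Dicyclic n = record
  { Carrier = Fin (2 * n) × Bool
  ; _≈_     = _≡_
  ; _∙_     = dicMul n
  ; ε       = (0 mod (2 * n) , false)
  }
  where instance _ = m*n≢0 2 n

-- Write x^i y^b ∈ D_{2n} as (i , b) and follow a product through the exponent i mod n:
-- a rotation adds its exponent, a reflection negates the exponent of everything to its
-- right.  Split a sequence of n + 1 terms into r rotations and reflections f₀, f₁, ….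
-- With at most one reflection, two of the first n + 1 prefix sums of the rotations agree
-- and the block between them has product 1.  With at least three reflections, the r + 1
-- prefix sums together with the values Σ + e(f₀) − e(fⱼ), j ≥ 1, are n + 1 residues, and
-- each kind of coincidence yields a product-one word of length ≤ n: a block, a suffix of
-- the rotations followed by f₀ fⱼ, or a pair fⱼ fⱼ′.  With exactly two reflections f, g,
-- fix v with 2v ≢ V = Σ + e(f) − e(g): either the n prefix sums miss v or V − v and two of
-- them collide, or two different prefix sums hit v and V − v, and (suffix) f (prefix) g
-- has product 1.
-- The projection Q_{4n} → D_{2n} has kernel {1, z = x^n} with z central of order 2, so two
-- disjoint short subsequences with product in the kernel combine to one of length ≤ 2n.
-- The lower bounds come from x^N and y x^{N−1}, where x has order N and y ∉ ⟨x⟩.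

module Submission where

open import Defs
open import Level using (0ℓ)
open import Function using (_∘_)
open import Function.Bundles using (Equivalence)
open import Data.Empty using (⊥-elim)
open import Data.Nat as ℕ using (ℕ; zero; suc; NonZero; _≤_; _<_; _∸_; _*_; z≤n; s≤s)
import Data.Nat.Properties as ℕ
import Data.Nat.Divisibility as ℕ
open import Data.Nat.DivMod using (_mod_)
open import Data.Bool as Bool using (Bool; true; false; not; _xor_; _∧_; _∨_; if_then_else_)
import Data.Bool.Properties as Bool
open import Data.Bool.ListAction using (all)
open import Data.Fin as Fin using (Fin; toℕ; fromℕ<; splitAt; punchOut)
import Data.Fin.Properties as Fin
open import Data.Integer as ℤ using (ℤ; +_; _+_; _-_; -_; 0ℤ; ∣_∣; _%ℕ_; _/ℕ_)
import Data.Integer.Properties as ℤ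
open import Data.Integer.DivMod using (n%ℕd<d; a≡a%ℕn+[a/ℕn]*n)
open import Data.Integer.Divisibility.Signed
  using (_∣_; _∣?_; divides; ∣-trans; ∣m∣n⇒∣m+n; ∣m⇒∣-m; ∣⇒∣ᵤ; ∣ᵤ⇒∣)
open import Data.Integer.Tactic.RingSolver using (solve-∀)
open import Data.Maybe using (Maybe; just; nothing; is-just; _<∣>_)
open import Data.Product using (_×_; _,_; proj₁; proj₂; ∃; ∃₂)
open import Data.Product.Properties using (≡-dec)
open import Data.Sum using (_⊎_; inj₁; inj₂; [_,_])
open import Data.List
  using (List; []; _∷_; _++_; length; map; foldr; take; drop; lookup; replicate; concatMap; allFin; cartesianProduct)
import Data.List.Properties as List
open import Data.List.Membership.Propositional using (_∈_)
open import Data.List.Membership.Propositional.Properties using (∈-lookup; ∈-cartesianProduct⁺; ∈-allFin)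
open import Data.List.Relation.Unary.Any using (here; there)
open import Data.List.Relation.Unary.All as All using (All; []; _∷_)
import Data.List.Relation.Unary.All.Properties as All
open import Data.List.Relation.Binary.Permutation.Propositional as Perm
  using (_↭_; prep; swap; ↭-refl; ↭-sym; ↭-trans; ↭-reflexive; module PermutationReasoning)
import Data.List.Relation.Binary.Permutation.Propositional.Properties as Perm
open import Data.List.Relation.Binary.Sublist.Propositional
  using (_⊆_; []; _∷_; _∷ʳ_; ⊆-refl; ⊆-trans; minimum; from∈)
import Data.List.Relation.Binary.Sublist.Propositional.Properties as Sublist
open import Algebra.Bundles.Raw using (RawMonoid)
open import Relation.Binary.Bundles using (Setoid)
open import Relation.Binary.Definitions using (tri<; tri≈; tri>)
import Relation.Binary.Reasoning.Setoid as SetoidReasoning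
open import Relation.Binary.PropositionalEquality
  using (_≡_; _≢_; refl; sym; trans; cong; cong₂; subst; subst₂; module ≡-Reasoning)
open import Relation.Nullary using (¬_; yes; no; contradiction)

twist : Bool → ℤ → ℤ
twist false k = k
twist true  k = - k

twist-+ : ∀ s a b → twist s (a + b) ≡ twist s a + twist s b
twist-+ false a b = refl
twist-+ true  a b = ℤ.neg-distrib-+ a b

module Congruence (m : ℕ) where

  -- A record, so that unification can recover a and b from a ≋ b.
  infix 4 _≋_
  record _≋_ (a b : ℤ) : Set where
    constructor ≋-intro
    field ∣-difference : + m ∣ a - b
  open _≋_

  ≋-reflexive : ∀ {a b} → a ≡ b → a ≋ b
  ≋-reflexive {a} refl = ≋-intro (divides 0ℤ (a-a≡0*m a (+ m)))
    where
    a-a≡0*m : ∀ a k → a - a ≡ 0ℤ ℤ.* k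
    a-a≡0*m = solve-∀

  ≋-refl : ∀ {a} → a ≋ a
  ≋-refl = ≋-reflexive refl

  ≋-sym : ∀ {a b} → a ≋ b → b ≋ a
  ≋-sym {a} {b} (≋-intro a≋b) = ≋-intro (subst (+ m ∣_) (-[a-b]≡b-a a b) (∣m⇒∣-m a≋b))
    where
    -[a-b]≡b-a : ∀ a b → - (a - b) ≡ b - a
    -[a-b]≡b-a = solve-∀

  ≋-trans : ∀ {a b c} → a ≋ b → b ≋ c → a ≋ c
  ≋-trans {a} {b} {c} (≋-intro a≋b) (≋-intro b≋c) =
    ≋-intro (subst (+ m ∣_) (telescope a b c) (∣m∣n⇒∣m+n a≋b b≋c))
    where
    telescope : ∀ a b c → (a - b) + (b - c) ≡ a - c
    telescope = solve-∀

  ≋-setoid : Setoid _ _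
  ≋-setoid = record
    { Carrier = ℤ ; _≈_ = _≋_
    ; isEquivalence = record { refl = ≋-refl ; sym = ≋-sym ; trans = ≋-trans } }

  module ≋-Reasoning = SetoidReasoning ≋-setoid

  +-cong : ∀ {a b c d} → a ≋ b → c ≋ d → a + c ≋ b + d
  +-cong {a} {b} {c} {d} (≋-intro a≋b) (≋-intro c≋d) =
    ≋-intro (subst (+ m ∣_) (regroup a b c d) (∣m∣n⇒∣m+n a≋b c≋d))
    where
    regroup : ∀ a b c d → (a - b) + (c - d) ≡ (a + c) - (b + d)
    regroup = solve-∀

  -‿cong : ∀ {a b} → a ≋ b → - a ≋ - b
  -‿cong {a} {b} (≋-intro a≋b) = ≋-intro (subst (+ m ∣_) (regroup a b) (∣m⇒∣-m a≋b))
    where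
    regroup : ∀ a b → - (a - b) ≡ - a - - b
    regroup = solve-∀

  ≋-rearrange : ∀ {a b x y} → a ≋ b → x - y ≡ a - b → x ≋ y
  ≋-rearrange (≋-intro m∣a-b) eq = ≋-intro (subst (+ m ∣_) (sym eq) m∣a-b)

  twist-cong : ∀ s {a b} → a ≋ b → twist s a ≋ twist s b
  twist-cong false a≋b = a≋b
  twist-cong true  a≋b = -‿cong a≋b

  m≋0 : + m ≋ 0ℤ
  m≋0 = ≋-intro (divides (+ 1) (m-0≡1*m (+ m)))
    where
    m-0≡1*m : ∀ k → k - 0ℤ ≡ + 1 ℤ.* k
    m-0≡1*m = solve-∀

  ∸-≋ : ∀ {j} → j ℕ.≤ m → + (m ℕ.∸ j) ≋ - + j
  ∸-≋ {j} j≤m = ≋-rearrange m≋0 (trans (cong (λ d → d - - + j) m∸j≡m-j) (shift (+ m) (+ j)))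
    where
    m∸j≡m-j : + (m ℕ.∸ j) ≡ + m - + j
    m∸j≡m-j = trans (sym (ℤ.⊖-≥ j≤m)) (sym (ℤ.m-n≡m⊖n m j))
    shift : ∀ k j → (k - j) - - j ≡ k - 0ℤ
    shift = solve-∀

  avoid-double : 3 ℕ.≤ m → ∀ V → ∃ λ v → ¬ (v + v ≋ V)
  avoid-double 3≤m V with + m ∣? V
  ... | yes m∣V = + 1 , λ 2≋V → 2≰m (ℕ.∣⇒≤ (∣⇒∣ᵤ (_≋_.∣-difference (≋-trans 2≋V V≋0))))
    where
    V≋0 : V ≋ 0ℤ
    V≋0 = ≋-intro (subst (+ m ∣_) (sym (ℤ.+-identityʳ V)) m∣V)
    2≰m : ¬ (m ℕ.≤ 2)
    2≰m = ℕ.<⇒≱ 3≤m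
  ... | no m∤V = 0ℤ , λ 0≋V → m∤V (subst (+ m ∣_) (ℤ.+-identityʳ V) (_≋_.∣-difference (≋-sym 0≋V)))

  private
    ≋-canonical-≤ : ∀ {a b} → a ℕ.≤ b → b ℕ.< m → + a ≋ + b → a ≡ b
    ≋-canonical-≤ {a} {b} a≤b b<m (≋-intro a≋b) = ℕ.≤-antisym a≤b (ℕ.m∸n≡0⇒m≤n b∸a≡0)
      where
      m∣b∸a : m ℕ.∣ b ℕ.∸ a
      m∣b∸a = subst (m ℕ.∣_) (trans (cong ∣_∣ (ℤ.m-n≡m⊖n a b)) (ℤ.∣⊖∣-≤ a≤b)) (∣⇒∣ᵤ a≋b)
      b∸a≡0 : b ℕ.∸ a ≡ 0
      b∸a≡0 with b ℕ.∸ a in eq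
      ... | zero  = refl
      ... | suc d = contradiction (subst (m ℕ.∣_) eq m∣b∸a)
                      (ℕ.>⇒∤ (subst (ℕ._< m) eq (ℕ.≤-<-trans (ℕ.m∸n≤m b a) b<m)))

  ≋0⇒∣ : ∀ {k} → + k ≋ 0ℤ → m ℕ.∣ k
  ≋0⇒∣ {k} (≋-intro m∣k-0) = subst (m ℕ.∣_) (ℕ.+-identityʳ k) (∣⇒∣ᵤ m∣k-0)

  ≋-canonical : ∀ {a b} → a ℕ.< m → b ℕ.< m → + a ≋ + b → a ≡ b
  ≋-canonical {a} {b} a<m b<m a≋b with ℕ.≤-total a b
  ... | inj₁ a≤b = ≋-canonical-≤ a≤b b<m a≋b
  ... | inj₂ b≤a = sym (≋-canonical-≤ b≤a a<m (≋-sym a≋b))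

  module _ .{{_ : NonZero m}} where

    %ℕ-≋ : ∀ a → + (a %ℕ m) ≋ a
    %ℕ-≋ a = ≋-sym (≋-intro (divides (a /ℕ m)
      (subst (λ x → x - r ≡ q ℤ.* + m) (sym (a≡a%ℕn+[a/ℕn]*n a m)) (cancel r q (+ m)))))
      where
      r q : ℤ
      r = + (a %ℕ m)
      q = a /ℕ m
      cancel : ∀ r q k → (r + q ℤ.* k) - r ≡ q ℤ.* k
      cancel = solve-∀

    residue : ℤ → Fin m
    residue a = fromℕ< (n%ℕd<d a m)

    residue-≋ : ∀ a → + toℕ (residue a) ≋ a
    residue-≋ a = subst (λ r → + r ≋ a) (sym (Fin.toℕ-fromℕ< (n%ℕd<d a m))) (%ℕ-≋ a)

    mod-≋ : ∀ k → + toℕ (k mod m) ≋ + k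
    mod-≋ k = residue-≋ (+ k)

    residue-injective : ∀ {a b} → residue a ≡ residue b → a ≋ b
    residue-injective {a} {b} eq =
      ≋-trans (≋-sym (residue-≋ a)) (subst (λ r → + toℕ r ≋ b) (sym eq) (residue-≋ b))

    ≋⇒≡ : ∀ {i j : Fin m} → + toℕ i ≋ + toℕ j → i ≡ j
    ≋⇒≡ {i} {j} i≋j = Fin.toℕ-injective (≋-canonical (Fin.toℕ<n i) (Fin.toℕ<n j) i≋j)

module Exponent (m : ℕ) .{{_ : NonZero m}} where

  open Congruence m

  exponent : Fin m × Bool → ℤ
  exponent (i , _) = + toℕ i

  ≋-ext : ∀ {g h} → exponent g ≋ exponent h → proj₂ g ≡ proj₂ h → g ≡ h
  ≋-ext {i , a} {j , .a} i≋j refl = cong (_, a) (≋⇒≡ i≋j)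

≋-weaken : ∀ {d m a b} → d ℕ.∣ m → Congruence._≋_ m a b → Congruence._≋_ d a b
≋-weaken d∣m (Congruence.≋-intro m∣a-b) = Congruence.≋-intro (∣-trans (∣ᵤ⇒∣ d∣m) m∣a-b)

module _ {A : Set} where

  infix 4 _⊑_
  _⊑_ : List A → List A → Set
  T ⊑ S = ∃ λ C → S ↭ T ++ C

  ↭⇒⊑ : ∀ {T S} → T ↭ S → T ⊑ S
  ↭⇒⊑ {T} T↭S = [] , ↭-trans (↭-sym T↭S) (↭-reflexive (sym (List.++-identityʳ T)))

  ⊆⇒⊑ : ∀ {T S} → T ⊆ S → T ⊑ S
  ⊆⇒⊑ {S = S} [] = S , ↭-refl
  ⊆⇒⊑ {T} (y ∷ʳ T⊆S) with ⊆⇒⊑ T⊆S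
  ... | C , S↭T++C = y ∷ C , ↭-trans (prep y S↭T++C) (↭-sym (Perm.shift y T C))
  ⊆⇒⊑ (refl ∷ T⊆S) with ⊆⇒⊑ T⊆S
  ... | C , S↭T++C = C , prep _ S↭T++C

  ⊑-trans : ∀ {T U S} → T ⊑ U → U ⊑ S → T ⊑ S
  ⊑-trans {T} (D , U↭T++D) (C , S↭U++C) =
    D ++ C , ↭-trans S↭U++C (↭-trans (Perm.++⁺ʳ C U↭T++D) (Perm.++-assoc T D C))

  ⊑-++⁺ : ∀ {T U T′ U′} → T ⊑ U → T′ ⊑ U′ → T ++ T′ ⊑ U ++ U′
  ⊑-++⁺ {T} {U} {T′} {U′} (C , U↭T++C) (C′ , U′↭T′++C′) = C ++ C′ , U++U′↭
    where
    open PermutationReasoning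
    U++U′↭ : U ++ U′ ↭ (T ++ T′) ++ C ++ C′
    U++U′↭ = begin
      U ++ U′               ↭⟨ Perm.++⁺ U↭T++C U′↭T′++C′ ⟩
      (T ++ C) ++ T′ ++ C′  ↭⟨ Perm.++-assoc T C (T′ ++ C′) ⟩
      T ++ C ++ T′ ++ C′    ↭⟨ Perm.++⁺ˡ T (Perm.shifts C T′) ⟩
      T ++ T′ ++ C ++ C′    ↭⟨ ↭-sym (Perm.++-assoc T T′ (C ++ C′)) ⟩
      (T ++ T′) ++ C ++ C′  ∎

  ⊆-↭⇒↭-⊆ : ∀ {xs ys zs : List A} → xs ⊆ ys → ys ↭ zs → ∃ λ ws → ws ⊆ zs × xs ↭ ws
  ⊆-↭⇒↭-⊆ {xs} p Perm.refl = xs , p , ↭-refl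
  ⊆-↭⇒↭-⊆ (x ∷ʳ p) (prep x ρ) with ⊆-↭⇒↭-⊆ p ρ
  ... | ws , q , σ = ws , x ∷ʳ q , σ
  ⊆-↭⇒↭-⊆ (refl ∷ p) (prep x ρ) with ⊆-↭⇒↭-⊆ p ρ
  ... | ws , q , σ = x ∷ ws , refl ∷ q , prep x σ
  ⊆-↭⇒↭-⊆ (x ∷ʳ (y ∷ʳ p)) (swap x y ρ) with ⊆-↭⇒↭-⊆ p ρ
  ... | ws , q , σ = ws , y ∷ʳ (x ∷ʳ q) , σ
  ⊆-↭⇒↭-⊆ (x ∷ʳ (refl ∷ p)) (swap x y ρ) with ⊆-↭⇒↭-⊆ p ρ
  ... | ws , q , σ = y ∷ ws , refl ∷ (x ∷ʳ q) , prep y σ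
  ⊆-↭⇒↭-⊆ (refl ∷ (y ∷ʳ p)) (swap x y ρ) with ⊆-↭⇒↭-⊆ p ρ
  ... | ws , q , σ = x ∷ ws , y ∷ʳ (refl ∷ q) , prep x σ
  ⊆-↭⇒↭-⊆ (refl ∷ (refl ∷ p)) (swap x y ρ) with ⊆-↭⇒↭-⊆ p ρ
  ... | ws , q , σ = y ∷ x ∷ ws , refl ∷ (refl ∷ q) , swap x y σ
  ⊆-↭⇒↭-⊆ p (Perm.trans ρ₁ ρ₂) with ⊆-↭⇒↭-⊆ p ρ₁
  ... | ws , q , σ with ⊆-↭⇒↭-⊆ q ρ₂
  ... | ws′ , q′ , σ′ = ws′ , q′ , ↭-trans σ σ′

  ⊑⇒⊆ : ∀ {T S : List A} → T ⊑ S → ∃ λ T′ → T′ ⊆ S × T ↭ T′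
  ⊑⇒⊆ {T} (C , S↭T++C) = ⊆-↭⇒↭-⊆ (Sublist.++⁺ʳ C ⊆-refl) (↭-sym S↭T++C)

  lookup-pair-⊆ : ∀ (L : List A) {j j′} → j Fin.< j′ → lookup L j ∷ lookup L j′ ∷ [] ⊆ L
  lookup-pair-⊆ (x ∷ L) {Fin.zero} {Fin.suc j′} _ = refl ∷ from∈ (∈-lookup j′)
  lookup-pair-⊆ (x ∷ L) {Fin.suc j} {Fin.suc j′} (ℕ.s≤s j<j′) = x ∷ʳ lookup-pair-⊆ L j<j′

  lookup-pair-⊑ : ∀ (L : List A) {j j′} → j ≢ j′ → lookup L j ∷ lookup L j′ ∷ [] ⊑ L
  lookup-pair-⊑ L {j} {j′} j≢j′ with Fin.<-cmp j j′
  ... | tri< j<j′ _ _ = ⊆⇒⊑ (lookup-pair-⊆ L j<j′)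
  ... | tri≈ _ j≡j′ _ = ⊥-elim (j≢j′ j≡j′)
  ... | tri> _ _ j′<j = ⊑-trans (↭⇒⊑ (swap _ _ ↭-refl)) (⊆⇒⊑ (lookup-pair-⊆ L j′<j))

  All-⊑ : ∀ {P : A → Set} {T S} → T ⊑ S → All P S → All P T
  All-⊑ {T = T} (C , S↭T++C) all = All.++⁻ˡ T (Perm.All-resp-↭ S↭T++C all)

  take++drop-⊆ : ∀ {i k} (L : List A) → i ℕ.≤ k → take i L ++ drop k L ⊆ L
  take++drop-⊆ {k = k} L ℕ.z≤n = Sublist.drop-⊆ k L
  take++drop-⊆ []      (ℕ.s≤s i≤k) = []
  take++drop-⊆ (x ∷ L) (ℕ.s≤s i≤k) = refl ∷ take++drop-⊆ L i≤k

  sandwich-↭ : ∀ X (f : A) Y g → X ++ f ∷ Y ++ g ∷ [] ↭ f ∷ g ∷ X ++ Y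
  sandwich-↭ X f Y g = begin
    X ++ f ∷ Y ++ g ∷ []        ↭⟨ Perm.shift f X (Y ++ g ∷ []) ⟩
    f ∷ X ++ Y ++ g ∷ []        ≡⟨ cong (f ∷_) (sym (List.++-assoc X Y (g ∷ []))) ⟩
    f ∷ (X ++ Y) ++ g ∷ []      ↭⟨ prep f (↭-sym (Perm.∷↭∷ʳ g (X ++ Y))) ⟩
    f ∷ g ∷ X ++ Y              ∎
    where open PermutationReasoning

  partition-↭ : (p : A → Bool) → ∀ S → ∃₂ λ Fs Ts →
    All (λ a → p a ≡ false) Fs × All (λ a → p a ≡ true) Ts × S ↭ Fs ++ Ts
  partition-↭ p [] = [] , [] , [] , [] , ↭-refl
  partition-↭ p (a ∷ S) with partition-↭ p S | p a in pa
  ... | Fs , Ts , allF , allT , S↭ | false = a ∷ Fs , Ts , pa ∷ allF , allT , prep a S↭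
  ... | Fs , Ts , allF , allT , S↭ | true  =
    Fs , a ∷ Ts , allF , pa ∷ allT , ↭-trans (prep a S↭) (↭-sym (Perm.shift a Fs Ts))

pigeonhole-split : ∀ {k l m} → m ℕ.< k ℕ.+ l → (f : Fin k → Fin m) (g : Fin l → Fin m) →
  (∃₂ λ i i′ → i Fin.< i′ × f i ≡ f i′) ⊎ (∃₂ λ i j → f i ≡ g j) ⊎ (∃₂ λ j j′ → j ≢ j′ × g j ≡ g j′)
pigeonhole-split {k} {l} m<k+l f g with Fin.pigeonhole m<k+l ([ f , g ] ∘ splitAt k)
... | a , b , a<b , eq with splitAt k a in ea | splitAt k b in eb
... | inj₁ i | inj₁ i′ = inj₁ (i , i′ , i<i′ , eq)
  where
  i<i′ : i Fin.< i′
  i<i′ = subst₂ ℕ._<_ (trans (cong toℕ (sym (Fin.splitAt⁻¹-↑ˡ ea))) (Fin.toℕ-↑ˡ i l))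
                       (trans (cong toℕ (sym (Fin.splitAt⁻¹-↑ˡ eb))) (Fin.toℕ-↑ˡ i′ l)) a<b
... | inj₁ i | inj₂ j  = inj₂ (inj₁ (i , j , eq))
... | inj₂ j | inj₁ i  = inj₂ (inj₁ (i , j , sym eq))
... | inj₂ j | inj₂ j′ = inj₂ (inj₂ (j , j′ , j≢j′ , eq))
  where
  j≢j′ : j ≢ j′
  j≢j′ refl = Fin.<⇒≢ a<b (trans (sym (Fin.splitAt⁻¹-↑ʳ ea)) (Fin.splitAt⁻¹-↑ʳ eb))

hit-or-collide : ∀ {k m} → m ℕ.≤ k → (f : Fin k → Fin m) (t : Fin m) →
  (∃ λ i → f i ≡ t) ⊎ (∃₂ λ i i′ → i Fin.< i′ × f i ≡ f i′)
hit-or-collide {k} {suc m} m<k f t with Fin.any? (λ i → f i Fin.≟ t)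
... | yes hit = inj₁ hit
... | no miss = inj₂ (collide (Fin.pigeonhole m<k (λ i → punchOut (t≢f i))))
  where
  t≢f : ∀ i → t ≢ f i
  t≢f i t≡fi = miss (i , sym t≡fi)
  collide : (∃₂ λ i i′ → i Fin.< i′ × punchOut (t≢f i) ≡ punchOut (t≢f i′)) →
            ∃₂ λ i i′ → i Fin.< i′ × f i ≡ f i′
  collide (i , i′ , i<i′ , eq) = i , i′ , i<i′ , Fin.punchOut-injective (t≢f i) (t≢f i′) eq

All-≡⇒replicate : ∀ {A : Set} {x : A} {U} → All (_≡ x) U → U ≡ replicate (length U) x
All-≡⇒replicate []            = refl
All-≡⇒replicate (refl ∷ xs) = cong (_ ∷_) (All-≡⇒replicate xs)

-- For the operations of Dihedral n and Dicyclic n, G unfolds to that RawMonoid.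
module ZeroSumInvariants {C : Set} (_∙_ : C → C → C) (ε : C) where

  G : RawMonoid 0ℓ 0ℓ
  G = record { Carrier = C ; _≈_ = _≡_ ; _∙_ = _∙_ ; ε = ε }

  _^_ : C → ℕ → C
  x ^ m = prod G (replicate m x)

  ShortProductOne : ℕ → List C → Set
  ShortProductOne ℓ S = ∃ λ T → T ⊑ S × 1 ≤ length T × length T ≤ ℓ × prod G T ≡ ε

  ShortProductOne⇒HasPOSubseqLen≤ : ∀ {ℓ S} → ShortProductOne ℓ S → HasPOSubseqLen≤ G S ℓ
  ShortProductOne⇒HasPOSubseqLen≤ (T , T⊑S , 1≤|T| , |T|≤ℓ , T≡ε) with ⊑⇒⊆ T⊑S
  ... | T′ , T′⊆S , T↭T′ = T′ , T′⊆S , subst (1 ≤_) (Perm.↭-length T↭T′) 1≤|T| ,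
                           subst (_≤ _) (Perm.↭-length T↭T′) |T|≤ℓ , T , T↭T′ , T≡ε

  module _ (σ : C → Bool) (σ-∙ : ∀ g h → σ (g ∙ h) ≡ σ g xor σ h) (σ-ε : σ ε ≡ false) where

    parity : List C → Bool
    parity = foldr (λ a b → σ a xor b) false

    σ-prod : ∀ T → σ (prod G T) ≡ parity T
    σ-prod []      = σ-ε
    σ-prod (a ∷ T) = trans (σ-∙ a (prod G T)) (cong (σ a xor_) (σ-prod T))

    parity-↭ : ∀ {T U} → T ↭ U → parity T ≡ parity U
    parity-↭ Perm.refl          = refl
    parity-↭ (prep a T↭U)  = cong (σ a xor_) (parity-↭ T↭U)
    parity-↭ (swap a b T↭U) = trans (sym (Bool.xor-assoc (σ a) (σ b) _))
      (trans (cong (_xor _) (Bool.xor-comm (σ a) (σ b)))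
        (trans (Bool.xor-assoc (σ b) (σ a) _) (cong (λ p → σ b xor (σ a xor p)) (parity-↭ T↭U))))
    parity-↭ (Perm.trans T↭U U↭V) = trans (parity-↭ T↭U) (parity-↭ U↭V)

    module _ (N : ℕ) (1≤N : 1 ≤ N)
             (short-product-one : ∀ S → length S ≡ suc N → ShortProductOne N S)
             (x y : C) (σx : σ x ≡ false) (σy : σ y ≡ true)
             (x^N≡ε : x ^ N ≡ ε) (x^m≢ε : ∀ m → 1 ≤ m → m < N → x ^ m ≢ ε) where

      parity-powers : ∀ {U} → All (_≡ x) U → parity U ≡ false
      parity-powers []            = refl
      parity-powers {_ ∷ U} (refl ∷ xs) = trans (cong (_xor parity U) σx) (parity-powers xs)

      power-product-one-length : ∀ {U} → All (_≡ x) U → 1 ≤ length U → prod G U ≡ ε → N ≤ length U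
      power-product-one-length {U} U≡x… 1≤|U| U≡ε with N ℕ.≤? length U
      ... | yes N≤|U| = N≤|U|
      ... | no  N≰|U| = contradiction (subst (λ V → prod G V ≡ ε) (All-≡⇒replicate U≡x…) U≡ε)
                                      (x^m≢ε (length U) 1≤|U| (ℕ.≰⇒> N≰|U|))

      powers-⊆ : ∀ {T m} → T ⊆ replicate m x → All (_≡ x) T
      powers-⊆ {m = m} T⊆xᵐ = Sublist.All-resp-⊆ T⊆xᵐ (All.replicate⁺ m refl)

      subsequence-of-power-length : ∀ {T m} → T ⊆ replicate m x → 1 ≤ length T → ProductOne G T → N ≤ length T
      subsequence-of-power-length T⊆xᵐ 1≤|T| (U , U↭T , U≡ε) =
        subst (N ≤_) (Perm.↭-length U↭T)
          (power-product-one-length (Perm.All-resp-↭ (↭-sym U↭T) (powers-⊆ T⊆xᵐ)) (subst (1 ≤_) (sym (Perm.↭-length U↭T)) 1≤|T|) U≡ε)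

      short : ∀ S → length S ≡ suc N → HasPOSubseqLen≤ G S N
      short S |S|≡1+N = ShortProductOne⇒HasPOSubseqLen≤ (short-product-one S |S|≡1+N)

      davenport : DavenportProp G (suc N)
      davenport S |S|≡1+N with short S |S|≡1+N
      ... | T , T⊆S , 1≤|T| , _ , T-product-one = T , T⊆S , 1≤|T| , T-product-one

      davenport-least : ∀ k → 1 ≤ k → DavenportProp G k → suc N ≤ k
      davenport-least k 1≤k d-prop with suc N ℕ.≤? k
      ... | yes 1+N≤k = 1+N≤k
      ... | no  1+N≰k = contradiction (d-prop (y ∷ replicate (k ∸ 1) x) |yxᵏ⁻¹|) no-product-one
        where
        |yxᵏ⁻¹| : length (y ∷ replicate (k ∸ 1) x) ≡ k
        |yxᵏ⁻¹| = trans (cong suc (List.length-replicate (k ∸ 1))) (ℕ.m+[n∸m]≡n 1≤k)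
        |xᵏ⁻¹|<N : length (replicate (k ∸ 1) x) < N
        |xᵏ⁻¹|<N = subst (_< N) (sym (List.length-replicate (k ∸ 1)))
                     (ℕ.<-≤-trans (ℕ.∸-monoʳ-< (s≤s z≤n) 1≤k) (ℕ.s≤s⁻¹ (ℕ.≰⇒> 1+N≰k)))
        no-product-one : ¬ HasPOSubseq G (y ∷ replicate (k ∸ 1) x)
        no-product-one (T , y ∷ʳ T⊆xᵏ⁻¹ , 1≤|T| , T-product-one) =
          ℕ.<⇒≱ (ℕ.≤-<-trans (Sublist.length-mono-≤ T⊆xᵏ⁻¹) |xᵏ⁻¹|<N)
                (subsequence-of-power-length T⊆xᵏ⁻¹ 1≤|T| T-product-one)
        no-product-one (y ∷ T , refl ∷ T⊆xᵏ⁻¹ , _ , U , U↭yT , U≡ε) = true≢false (begin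
          true                 ≡⟨ cong (_xor false) (sym σy) ⟩
          σ y xor false        ≡⟨ cong (σ y xor_) (sym (parity-powers (powers-⊆ T⊆xᵏ⁻¹))) ⟩
          parity (y ∷ T)       ≡⟨ sym (parity-↭ U↭yT) ⟩
          parity U             ≡⟨ sym (σ-prod U) ⟩
          σ (prod G U)         ≡⟨ cong σ U≡ε ⟩
          σ ε                  ≡⟨ σ-ε ⟩
          false                ∎)
          where
          open ≡-Reasoning
          true≢false : true ≢ false
          true≢false ()

      f-least : ∀ k → 1 ≤ k → FProp G (suc N) k → N ≤ k
      f-least k _ f-prop with f-prop (replicate (suc N) x) (List.length-replicate (suc N))
      ... | T , T⊆xᴺ⁺¹ , 1≤|T| , |T|≤k , T-product-one =
        ℕ.≤-trans (subsequence-of-power-length T⊆xᴺ⁺¹ 1≤|T| T-product-one) |T|≤k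

      e-prop : EProp G N
      e-prop S S≢[] S-product-one with length S ℕ.≤? N
      ... | yes |S|≤N = S , ⊆-refl , nonempty S S≢[] , |S|≤N , S-product-one
        where
        nonempty : ∀ S → S ≢ [] → 1 ≤ length S
        nonempty []      S≢[] = contradiction refl S≢[]
        nonempty (_ ∷ _) _    = s≤s z≤n
      ... | no  |S|≰N with short (take (suc N) S) |take|
        where
        |take| : length (take (suc N) S) ≡ suc N
        |take| = trans (List.length-take (suc N) S) (ℕ.m≤n⇒m⊓n≡m (ℕ.≰⇒> |S|≰N))
      ...   | T , T⊆S′ , T-short = T , ⊆-trans T⊆S′ (Sublist.take-⊆ (suc N) S) , T-short

      e-least : ∀ k → 1 ≤ k → EProp G k → N ≤ k
      e-least k _ e-prop′ with e-prop′ (replicate N x) xᴺ≢[] (replicate N x , ↭-refl , x^N≡ε)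
        where
        xᴺ≢[] : replicate N x ≢ []
        xᴺ≢[] xᴺ≡[] = ℕ.<⇒≢ 1≤N (sym (trans (sym (List.length-replicate N)) (cong length xᴺ≡[])))
      ... | T , T⊆xᴺ , 1≤|T| , |T|≤k , T-product-one =
        ℕ.≤-trans (subsequence-of-power-length T⊆xᴺ 1≤|T| T-product-one) |T|≤k

      invariants : FIs G N × EIs G N × DavenportIs G (suc N)
      invariants = (suc N , d , 1≤N , short , f-least) , (1≤N , e-prop , e-least) , d
        where
        d : DavenportIs G (suc N)
        d = s≤s z≤n , davenport , davenport-least

module RotationPowers (M : ℕ) .{{_ : NonZero M}} (_∙_ : Fin M × Bool → Fin M × Bool → Fin M × Bool) where

  open Congruence M
  open Exponent M
  open ZeroSumInvariants _∙_ (0 mod M , false) using (_^_)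

  x : Fin M × Bool
  x = (1 mod M , false)

  module _ (x-∙ : ∀ h → exponent (x ∙ h) ≋ + 1 + exponent h × proj₂ (x ∙ h) ≡ proj₂ h) where

    exponent-^ : ∀ m → exponent (x ^ m) ≋ + m × proj₂ (x ^ m) ≡ false
    exponent-^ zero    = mod-≋ 0 , refl
    exponent-^ (suc m) = ≋-trans (proj₁ (x-∙ (x ^ m))) (+-cong (≋-refl {+ 1}) (proj₁ (exponent-^ m))) ,
                         trans (proj₂ (x-∙ (x ^ m))) (proj₂ (exponent-^ m))

    x^M≡ε : x ^ M ≡ (0 mod M , false)
    x^M≡ε = ≋-ext (≋-trans (proj₁ (exponent-^ M)) (≋-trans m≋0 (≋-sym (mod-≋ 0)))) (proj₂ (exponent-^ M))

    x^m≢ε : ∀ m → 1 ≤ m → m < M → x ^ m ≢ (0 mod M , false)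
    x^m≢ε m 1≤m m<M x^m≡ε = ℕ.<⇒≢ 1≤m (sym (≋-canonical m<M 0<M +m≋0))
      where
      0<M : 0 < M
      0<M = ℕ.≤-<-trans z≤n m<M
      +m≋0 : + m ≋ + 0
      +m≋0 = ≋-trans (≋-sym (proj₁ (exponent-^ m))) (≋-trans (≋-reflexive (cong exponent x^m≡ε)) (mod-≋ 0))

module DihedralExponents (n : ℕ) .{{_ : NonZero n}} where

  open RawMonoid (Dihedral n) using (Carrier; _∙_; ε)
  open Congruence n
  open Exponent n

  exponent-∙ : ∀ g h → exponent (g ∙ h) ≋ exponent g + twist (proj₂ g) (exponent h)
  exponent-∙ (i , false) (j , _) = begin
    + toℕ ((toℕ i ℕ.+ toℕ j) mod n)  ≈⟨ mod-≋ (toℕ i ℕ.+ toℕ j) ⟩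
    + (toℕ i ℕ.+ toℕ j)              ≡⟨ ℤ.pos-+ (toℕ i) (toℕ j) ⟩
    + toℕ i + + toℕ j                ∎
    where open ≋-Reasoning
  exponent-∙ (i , true) (j , _) = begin
    + toℕ ((toℕ i ℕ.+ (n ℕ.∸ toℕ j)) mod n)  ≈⟨ mod-≋ (toℕ i ℕ.+ (n ℕ.∸ toℕ j)) ⟩
    + (toℕ i ℕ.+ (n ℕ.∸ toℕ j))              ≡⟨ ℤ.pos-+ (toℕ i) (n ℕ.∸ toℕ j) ⟩
    + toℕ i + + (n ℕ.∸ toℕ j)                ≈⟨ +-cong (≋-refl {+ toℕ i}) (∸-≋ (ℕ.<⇒≤ (Fin.toℕ<n j))) ⟩
    + toℕ i + - + toℕ j                      ∎
    where open ≋-Reasoning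

  module Words {A : Set} (φ : A → Carrier) where

    eval : List A → Carrier
    eval T = prod (Dihedral n) (map φ T)

    exp : A → ℤ
    exp a = exponent (φ a)

    IsRotation IsReflection : A → Set
    IsRotation   a = proj₂ (φ a) ≡ false
    IsReflection a = proj₂ (φ a) ≡ true

    Σexp : List A → ℤ
    Σexp []      = 0ℤ
    Σexp (a ∷ T) = exp a + Σexp T

    Σexp-++ : ∀ X Y → Σexp (X ++ Y) ≡ Σexp X + Σexp Y
    Σexp-++ []      Y = sym (ℤ.+-identityˡ (Σexp Y))
    Σexp-++ (a ∷ X) Y = trans (cong (λ w → exp a + w) (Σexp-++ X Y)) (sym (ℤ.+-assoc (exp a) (Σexp X) (Σexp Y)))

    Evaluates : List A → ℤ → Bool → Set
    Evaluates T e o = exponent (eval T) ≋ e × proj₂ (eval T) ≡ o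

    Evaluates⇒≡ε : ∀ {T} → Evaluates T (exponent ε) false → eval T ≡ ε
    Evaluates⇒≡ε (T≋ε , T-rotation) = ≋-ext T≋ε T-rotation

    eval-++-rotations : ∀ {X} L → All IsRotation X → Evaluates (X ++ L) (Σexp X + exponent (eval L)) (proj₂ (eval L))
    eval-++-rotations L [] = ≋-reflexive (sym (ℤ.+-identityˡ _)) , refl
    eval-++-rotations {a ∷ X} L (rot ∷ rots) =
      exp≋ , trans (cong (_xor proj₂ (eval (X ++ L))) rot) (proj₂ (eval-++-rotations L rots))
      where
      exp≋ : exponent (eval (a ∷ X ++ L)) ≋ exp a + Σexp X + exponent (eval L)
      exp≋ = begin
        exponent (eval (a ∷ X ++ L))                             ≈⟨ exponent-∙ (φ a) (eval (X ++ L)) ⟩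
        exp a + twist (proj₂ (φ a)) (exponent (eval (X ++ L)))  ≡⟨ cong (λ b → exp a + twist b (exponent (eval (X ++ L)))) rot ⟩
        exp a + exponent (eval (X ++ L))                         ≈⟨ +-cong (≋-refl {exp a}) (proj₁ (eval-++-rotations L rots)) ⟩
        exp a + (Σexp X + exponent (eval L))                     ≡⟨ sym (ℤ.+-assoc (exp a) (Σexp X) _) ⟩
        exp a + Σexp X + exponent (eval L)                       ∎
        where open ≋-Reasoning

    eval-∷-reflection : ∀ {a} L → IsReflection a → Evaluates (a ∷ L) (exp a - exponent (eval L)) (not (proj₂ (eval L)))
    eval-∷-reflection {a} L ref =
      ≋-trans (exponent-∙ (φ a) (eval L)) (≋-reflexive (cong (λ b → exp a + twist b (exponent (eval L))) ref)) ,
      cong (_xor proj₂ (eval L)) ref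

    eval-sandwich : ∀ {f Y g} L → IsReflection f → All IsRotation Y → IsReflection g →
      Evaluates (f ∷ Y ++ g ∷ L) (exp f - (Σexp Y + (exp g - exponent (eval L)))) (proj₂ (eval L))
    eval-sandwich {f} {Y} {g} L ref-f rots ref-g =
      ≋-trans (proj₁ f-step) (+-cong (≋-refl {exp f}) (-‿cong (≋-trans (proj₁ Y-step) (+-cong (≋-refl {Σexp Y}) (proj₁ g-step))))) ,
      trans (proj₂ f-step) (trans (cong not (trans (proj₂ Y-step) (proj₂ g-step))) (Bool.not-involutive (proj₂ (eval L))))
      where
      f-step : Evaluates (f ∷ Y ++ g ∷ L) (exp f - exponent (eval (Y ++ g ∷ L))) (not (proj₂ (eval (Y ++ g ∷ L))))
      f-step = eval-∷-reflection (Y ++ g ∷ L) ref-f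
      Y-step : Evaluates (Y ++ g ∷ L) (Σexp Y + exponent (eval (g ∷ L))) (proj₂ (eval (g ∷ L)))
      Y-step = eval-++-rotations (g ∷ L) rots
      g-step : Evaluates (g ∷ L) (exp g - exponent (eval L)) (not (proj₂ (eval L)))
      g-step = eval-∷-reflection L ref-g

    rotations-product-one : ∀ {X} → All IsRotation X → Σexp X ≋ 0ℤ → eval X ≡ ε
    rotations-product-one {X} rots X≋0 = subst (λ T → eval T ≡ ε) (List.++-identityʳ X)
      (Evaluates⇒≡ε {X ++ []} (≋-trans (proj₁ X-step) (≋-rearrange {Σexp X} {0ℤ} {Σexp X + exponent ε} {exponent ε}
        X≋0 (cancel (Σexp X) (exponent ε))) , proj₂ X-step))
      where
      X-step : Evaluates (X ++ []) (Σexp X + exponent ε) false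
      X-step = eval-++-rotations [] rots
      cancel : ∀ w e → (w + e) - e ≡ w - 0ℤ
      cancel = solve-∀

    sandwich-product-one : ∀ {X f Y g} → All IsRotation X → IsReflection f → All IsRotation Y → IsReflection g →
      Σexp X + exp f ≋ Σexp Y + exp g → eval (X ++ f ∷ Y ++ g ∷ []) ≡ ε
    sandwich-product-one {X} {f} {Y} {g} rots-X ref-f rots-Y ref-g balanced = Evaluates⇒≡ε {X ++ f ∷ Y ++ g ∷ []}
      (≋-trans (proj₁ X-step) (≋-trans (+-cong (≋-refl {Σexp X}) (proj₁ fYg-step))
        (≋-rearrange {Σexp X + exp f} {Σexp Y + exp g} {Σexp X + (exp f - (Σexp Y + (exp g - e)))} {e}
          balanced (cancel (Σexp X) (exp f) (Σexp Y) (exp g) e))) ,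
       trans (proj₂ X-step) (proj₂ fYg-step))
      where
      e : ℤ
      e = exponent ε
      X-step : Evaluates (X ++ f ∷ Y ++ g ∷ []) (Σexp X + exponent (eval (f ∷ Y ++ g ∷ []))) (proj₂ (eval (f ∷ Y ++ g ∷ [])))
      X-step = eval-++-rotations (f ∷ Y ++ g ∷ []) rots-X
      fYg-step : Evaluates (f ∷ Y ++ g ∷ []) (exp f - (Σexp Y + (exp g - e))) false
      fYg-step = eval-sandwich [] ref-f rots-Y ref-g
      cancel : ∀ x f y g e → (x + (f - (y + (g - e)))) - e ≡ (x + f) - (y + g)
      cancel = solve-∀

    ShortImageProductOne : ℕ → List A → Set
    ShortImageProductOne ℓ S = ∃ λ T → T ⊑ S × 1 ≤ length T × length T ≤ ℓ × eval T ≡ ε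

    ShortImageProductOne-mono : ∀ {ℓ ℓ′ S} → ℓ ≤ ℓ′ → ShortImageProductOne ℓ S → ShortImageProductOne ℓ′ S
    ShortImageProductOne-mono ℓ≤ℓ′ (T , T⊑S , 1≤|T| , |T|≤ℓ , T≡ε) = T , T⊑S , 1≤|T| , ℕ.≤-trans |T|≤ℓ ℓ≤ℓ′ , T≡ε

    module Partitioned {S Rs Fs : List A} (rots : All IsRotation Rs) (refs : All IsReflection Fs)
                       (S↭Rs++Fs : S ↭ Rs ++ Fs) where

      r : ℕ
      r = length Rs

      prefix-sum : ℕ → ℤ
      prefix-sum i = Σexp (take i Rs)

      parts-⊑ : ∀ {X Y} → X ⊑ Rs → Y ⊑ Fs → X ++ Y ⊑ S
      parts-⊑ X⊑Rs Y⊑Fs = ⊑-trans (⊑-++⁺ X⊑Rs Y⊑Fs) (↭⇒⊑ (↭-sym S↭Rs++Fs))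

      from-rotations : ∀ {X} → X ⊑ Rs → 1 ≤ length X → Σexp X ≋ 0ℤ → ShortImageProductOne (length X) S
      from-rotations {X} X⊑Rs 1≤|X| X≋0 =
        X , subst (_⊑ S) (List.++-identityʳ X) (parts-⊑ X⊑Rs (⊆⇒⊑ (minimum Fs))) , 1≤|X| , ℕ.≤-refl ,
        rotations-product-one (All-⊑ X⊑Rs rots) X≋0

      from-sandwich : ∀ {X Y f g} → X ++ Y ⊑ Rs → f ∷ g ∷ [] ⊑ Fs →
        Σexp X + exp f ≋ Σexp Y + exp g → ShortImageProductOne (2 ℕ.+ length (X ++ Y)) S
      from-sandwich {X} {Y} {f} {g} XY⊑Rs fg⊑Fs balanced =
        T , ⊑-trans (↭⇒⊑ (↭-trans T↭ (Perm.++-comm (f ∷ g ∷ []) (X ++ Y)))) (parts-⊑ XY⊑Rs fg⊑Fs) ,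
        subst (1 ≤_) (sym (Perm.↭-length T↭)) (s≤s z≤n) , ℕ.≤-reflexive (Perm.↭-length T↭) ,
        sandwich-product-one (All.++⁻ˡ X rots-XY) (All.head refs-fg) (All.++⁻ʳ X rots-XY) (All.head (All.tail refs-fg)) balanced
        where
        T : List A
        T = X ++ f ∷ Y ++ g ∷ []
        T↭ : T ↭ f ∷ g ∷ X ++ Y
        T↭ = sandwich-↭ X f Y g
        rots-XY : All IsRotation (X ++ Y)
        rots-XY = All-⊑ XY⊑Rs rots
        refs-fg : All IsReflection (f ∷ g ∷ [])
        refs-fg = All-⊑ fg⊑Fs refs

      prefix-sum-split : ∀ {i k} → i ≤ k → prefix-sum k ≡ prefix-sum i + Σexp (drop i (take k Rs))
      prefix-sum-split {i} {k} i≤k = begin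
        prefix-sum k                                           ≡⟨ cong Σexp (sym (List.take++drop≡id i (take k Rs))) ⟩
        Σexp (take i (take k Rs) ++ drop i (take k Rs))       ≡⟨ Σexp-++ (take i (take k Rs)) _ ⟩
        Σexp (take i (take k Rs)) + Σexp (drop i (take k Rs)) ≡⟨ cong (λ P → Σexp P + Σexp (drop i (take k Rs))) take-i-k ⟩
        prefix-sum i + Σexp (drop i (take k Rs))               ∎
        where
        open ≡-Reasoning
        take-i-k : take i (take k Rs) ≡ take i Rs
        take-i-k = trans (List.take-take i k Rs) (cong (λ j → take j Rs) (ℕ.m≤n⇒m⊓n≡m i≤k))

      Σexp-take-drop : ∀ i → Σexp Rs ≡ prefix-sum i + Σexp (drop i Rs)
      Σexp-take-drop i = trans (cong Σexp (sym (List.take++drop≡id i Rs))) (Σexp-++ (take i Rs) (drop i Rs))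

      from-block : ∀ {i k} → i < k → k ≤ r → prefix-sum i ≋ prefix-sum k → ShortImageProductOne (k ℕ.∸ i) S
      from-block {i} {k} i<k k≤r prefix-i≋prefix-k =
        subst (λ ℓ → ShortImageProductOne ℓ S) |B|
          (from-rotations B⊑Rs (subst (1 ≤_) (sym |B|) (ℕ.m<n⇒0<n∸m i<k)) B≋0)
        where
        B : List A
        B = drop i (take k Rs)
        B⊑Rs : B ⊑ Rs
        B⊑Rs = ⊆⇒⊑ (⊆-trans (Sublist.drop-⊆ i (take k Rs)) (Sublist.take-⊆ k Rs))
        |B| : length B ≡ k ℕ.∸ i
        |B| = trans (List.length-drop i (take k Rs)) (cong (ℕ._∸ i) (trans (List.length-take k Rs) (ℕ.m≤n⇒m⊓n≡m k≤r)))
        cancel : ∀ p w → w - 0ℤ ≡ (p + w) - p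
        cancel = solve-∀
        B≋0 : Σexp B ≋ 0ℤ
        B≋0 = ≋-rearrange (≋-sym prefix-i≋prefix-k)
          (trans (cancel (prefix-sum i) (Σexp B)) (cong (_- prefix-sum i) (sym (prefix-sum-split (ℕ.<⇒≤ i<k)))))

      prefix-residue : ∀ {m} → Fin m → Fin n
      prefix-residue i = residue (prefix-sum (toℕ i))

      from-prefix-collision : ∀ {i k : Fin (suc r)} → i Fin.< k → prefix-residue i ≡ prefix-residue k →
                              ShortImageProductOne r S
      from-prefix-collision {i} {k} i<k same-residue =
        ShortImageProductOne-mono (ℕ.≤-trans (ℕ.m∸n≤m (toℕ k) (toℕ i)) k≤r)
          (from-block i<k k≤r (residue-injective same-residue))
        where
        k≤r : toℕ k ≤ r
        k≤r = ℕ.s≤s⁻¹ (Fin.toℕ<n k)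

      few-reflections : n ≤ r → ShortImageProductOne n S
      few-reflections n≤r with Fin.pigeonhole (ℕ.n<1+n n) (prefix-residue {suc n})
      ... | i , k , i<k , same-residue = ShortImageProductOne-mono (ℕ.≤-trans (ℕ.m∸n≤m (toℕ k) (toℕ i)) k≤n)
        (from-block i<k (ℕ.≤-trans k≤n n≤r) (residue-injective same-residue))
        where
        k≤n : toℕ k ≤ n
        k≤n = ℕ.s≤s⁻¹ (Fin.toℕ<n k)

      module TwoReflections {f g : A} (Fs≡fg : Fs ≡ f ∷ g ∷ []) (1+r≡n : suc r ≡ n) where

        fg⊑Fs : f ∷ g ∷ [] ⊑ Fs
        fg⊑Fs = ↭⇒⊑ (↭-reflexive (sym Fs≡fg))

        from-wrap : ∀ {i k} → i < k → k ≤ r → prefix-sum i + prefix-sum k ≋ Σexp Rs + exp f - exp g →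
                    ShortImageProductOne n S
        from-wrap {i} {k} i<k k≤r sum≋ = ShortImageProductOne-mono |T|≤n (from-sandwich {X} {Y} XY⊑Rs fg⊑Fs balanced)
          where
          X Y : List A
          X = drop k Rs
          Y = take i Rs
          XY⊑Rs : X ++ Y ⊑ Rs
          XY⊑Rs = ⊑-trans (↭⇒⊑ (Perm.++-comm X Y)) (⊆⇒⊑ (take++drop-⊆ Rs (ℕ.<⇒≤ i<k)))
          cancel : ∀ x f y g p → (x + f) - (y + g) ≡ ((p + x) + f - g) - (y + p)
          cancel = solve-∀
          balanced : Σexp X + exp f ≋ Σexp Y + exp g
          balanced = ≋-rearrange (≋-sym sum≋)
            (trans (cancel (Σexp X) (exp f) (prefix-sum i) (exp g) (prefix-sum k))
                   (cong (λ w → (w + exp f - exp g) - (prefix-sum i + prefix-sum k)) (sym (Σexp-take-drop k))))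
          |XY| : length (X ++ Y) ≡ r ℕ.∸ k ℕ.+ i
          |XY| = trans (List.length-++ X) (cong₂ ℕ._+_ (List.length-drop k Rs)
                   (trans (List.length-take i Rs) (ℕ.m≤n⇒m⊓n≡m (ℕ.≤-trans (ℕ.<⇒≤ i<k) k≤r))))
          |T|≤n : 2 ℕ.+ length (X ++ Y) ≤ n
          |T|≤n = subst (λ ℓ → 2 ℕ.+ ℓ ≤ n) (sym |XY|) (subst (_ ≤_) 1+r≡n (s≤s (begin-strict
            r ℕ.∸ k ℕ.+ i  <⟨ ℕ.+-monoʳ-< (r ℕ.∸ k) i<k ⟩
            r ℕ.∸ k ℕ.+ k  ≡⟨ ℕ.m∸n+n≡m k≤r ⟩
            r              ∎)))
            where open ℕ.≤-Reasoning

        V : ℤ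
        V = Σexp Rs + exp f - exp g

        n≤1+r : n ≤ suc r
        n≤1+r = ℕ.≤-reflexive (sym 1+r≡n)

        r≤n : r ≤ n
        r≤n = subst (r ≤_) 1+r≡n (ℕ.n≤1+n r)

        v+[V-v]≡V : ∀ v V → v + (V - v) ≡ V
        v+[V-v]≡V = solve-∀

        [V-v]+v≡V : ∀ v V → (V - v) + v ≡ V
        [V-v]+v≡V = solve-∀

        from-hits : ∀ {v} (i k : Fin (suc r)) → ¬ (v + v ≋ V) → prefix-sum (toℕ i) ≋ v → prefix-sum (toℕ k) ≋ V - v →
                    ShortImageProductOne n S
        from-hits {v} i k 2v≉V i≋v k≋V-v with Fin.<-cmp i k
        ... | tri< i<k _ _ = from-wrap i<k (ℕ.s≤s⁻¹ (Fin.toℕ<n k)) (≋-trans (+-cong i≋v k≋V-v) (≋-reflexive (v+[V-v]≡V v V)))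
        ... | tri≈ _ refl _ = contradiction (≋-trans (+-cong (≋-trans (≋-sym i≋v) k≋V-v) (≋-refl {v}))
                                            (≋-reflexive ([V-v]+v≡V v V))) 2v≉V
        ... | tri> _ _ k<i = from-wrap k<i (ℕ.s≤s⁻¹ (Fin.toℕ<n i)) (≋-trans (+-cong k≋V-v i≋v) (≋-reflexive ([V-v]+v≡V v V)))

        short-product-one : 3 ≤ n → ShortImageProductOne n S
        short-product-one 3≤n with avoid-double 3≤n V
        ... | v , 2v≉V with hit-or-collide n≤1+r prefix-residue (residue v)
        ...   | inj₂ (_ , _ , i<i′ , same) = ShortImageProductOne-mono r≤n (from-prefix-collision i<i′ same)
        ...   | inj₁ (i , i-hit) with hit-or-collide n≤1+r prefix-residue (residue (V - v))
        ...     | inj₂ (_ , _ , k<k′ , same) = ShortImageProductOne-mono r≤n (from-prefix-collision k<k′ same)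
        ...     | inj₁ (k , k-hit) = from-hits i k 2v≉V (residue-injective i-hit) (residue-injective k-hit)

      module ManyReflections {f₀ : A} {Fs′ : List A} (Fs≡f₀Fs′ : Fs ≡ f₀ ∷ Fs′) (2≤l : 2 ≤ length Fs′)
               (r+l≡n : r ℕ.+ length Fs′ ≡ n) where

        Fs′⊑Fs : Fs′ ⊑ Fs
        Fs′⊑Fs = subst (Fs′ ⊑_) (sym Fs≡f₀Fs′) (⊆⇒⊑ (f₀ ∷ʳ ⊆-refl))

        V : Fin (length Fs′) → ℤ
        V j = Σexp Rs + exp f₀ - exp (lookup Fs′ j)

        2+r≤n : 2 ℕ.+ r ≤ n
        2+r≤n = subst (_ ≤_) r+l≡n (subst (_≤ r ℕ.+ length Fs′) (ℕ.+-comm r 2) (ℕ.+-monoʳ-≤ r 2≤l))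

        from-suffix : ∀ i j → prefix-sum i ≋ V j → ShortImageProductOne n S
        from-suffix i j prefix≋V = ShortImageProductOne-mono |T|≤n (from-sandwich {X} {[]} X⊑Rs f₀fⱼ⊑Fs balanced)
          where
          X : List A
          X = drop i Rs
          X⊑Rs : X ++ [] ⊑ Rs
          X⊑Rs = subst (_⊑ Rs) (sym (List.++-identityʳ X)) (⊆⇒⊑ (Sublist.drop-⊆ i Rs))
          f₀fⱼ⊑Fs : f₀ ∷ lookup Fs′ j ∷ [] ⊑ Fs
          f₀fⱼ⊑Fs = subst (f₀ ∷ lookup Fs′ j ∷ [] ⊑_) (sym Fs≡f₀Fs′) (⊆⇒⊑ (refl ∷ from∈ (∈-lookup j)))
          cancel : ∀ x f g p → (x + f) - (0ℤ + g) ≡ ((p + x) + f - g) - p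
          cancel = solve-∀
          balanced : Σexp X + exp f₀ ≋ Σexp [] + exp (lookup Fs′ j)
          balanced = ≋-rearrange (≋-sym prefix≋V)
            (trans (cancel (Σexp X) (exp f₀) (exp (lookup Fs′ j)) (prefix-sum i))
                   (cong (λ w → (w + exp f₀ - exp (lookup Fs′ j)) - prefix-sum i) (sym (Σexp-take-drop i))))
          |X| : length (X ++ []) ≤ r
          |X| = subst (_≤ r) (sym (trans (cong length (List.++-identityʳ X)) (List.length-drop i Rs))) (ℕ.m∸n≤m r i)
          |T|≤n : 2 ℕ.+ length (X ++ []) ≤ n
          |T|≤n = ℕ.≤-trans (ℕ.+-monoʳ-≤ 2 |X|) 2+r≤n

        from-pair : ∀ {j j′} → j ≢ j′ → V j ≋ V j′ → ShortImageProductOne n S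
        from-pair {j} {j′} j≢j′ Vj≋Vj′ = ShortImageProductOne-mono (ℕ.≤-trans (ℕ.m≤m+n 2 r) 2+r≤n)
          (from-sandwich {[]} {[]} (⊆⇒⊑ (minimum Rs)) (⊑-trans (lookup-pair-⊑ Fs′ j≢j′) Fs′⊑Fs) balanced)
          where
          cancel : ∀ w f g g′ → (0ℤ + g) - (0ℤ + g′) ≡ (w + f - g′) - (w + f - g)
          cancel = solve-∀
          balanced : Σexp [] + exp (lookup Fs′ j) ≋ Σexp [] + exp (lookup Fs′ j′)
          balanced = ≋-rearrange (≋-sym Vj≋Vj′)
            (cancel (Σexp Rs) (exp f₀) (exp (lookup Fs′ j)) (exp (lookup Fs′ j′)))

        short-product-one : ShortImageProductOne n S
        short-product-one with pigeonhole-split n<1+r+l prefix-residue (λ j → residue (V j))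
          where
          n<1+r+l : n < suc r ℕ.+ length Fs′
          n<1+r+l = s≤s (ℕ.≤-reflexive (sym r+l≡n))
        ... | inj₁ (_ , _ , i<i′ , same) =
          ShortImageProductOne-mono (ℕ.≤-trans (ℕ.m≤n+m r 2) 2+r≤n) (from-prefix-collision i<i′ same)
        ... | inj₂ (inj₁ (i , j , same)) = from-suffix (toℕ i) j (residue-injective same)
        ... | inj₂ (inj₂ (j , j′ , j≢j′ , same)) = from-pair j≢j′ (residue-injective same)

    dihedral-short-product-one : 3 ≤ n → ∀ S → length S ≡ suc n → ShortImageProductOne n S
    dihedral-short-product-one 3≤n S |S|≡1+n with partition-↭ (proj₂ ∘ φ) S
    ... | Rs , Fs , rots , refs , S↭ =
      by-reflection-count Fs refs S↭ (trans (sym (List.length-++ Rs)) (trans (sym (Perm.↭-length S↭)) |S|≡1+n))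
      where
      open Partitioned using (few-reflections; module TwoReflections; module ManyReflections)
      by-reflection-count : ∀ Fs → All IsReflection Fs → S ↭ Rs ++ Fs → length Rs ℕ.+ length Fs ≡ suc n →
                            ShortImageProductOne n S
      by-reflection-count [] refs S↭ r+0≡1+n =
        few-reflections rots refs S↭ (ℕ.≤-trans (ℕ.n≤1+n n) (ℕ.≤-reflexive (trans (sym r+0≡1+n) (ℕ.+-identityʳ _))))
      by-reflection-count (_ ∷ []) refs S↭ r+1≡1+n =
        few-reflections rots refs S↭ (ℕ.≤-reflexive (ℕ.suc-injective (trans (sym r+1≡1+n) (ℕ.+-comm _ 1))))
      by-reflection-count (_ ∷ _ ∷ []) refs S↭ r+2≡1+n =
        TwoReflections.short-product-one rots refs S↭ refl (ℕ.suc-injective (trans (ℕ.+-comm 2 _) r+2≡1+n)) 3≤n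
      by-reflection-count (_ ∷ f₁ ∷ f₂ ∷ Fs′) refs S↭ r+3+l≡1+n =
        ManyReflections.short-product-one rots refs S↭ refl (s≤s (s≤s z≤n))
          (ℕ.suc-injective (trans (sym (ℕ.+-suc _ _)) r+3+l≡1+n))

  rotation-∙ : ∀ h → exponent ((1 mod n , false) ∙ h) ≋ + 1 + exponent h × proj₂ ((1 mod n , false) ∙ h) ≡ proj₂ h
  rotation-∙ h = ≋-trans (exponent-∙ (1 mod n , false) h) (+-cong (mod-≋ 1) (≋-refl {exponent h})) , refl

multiple<double : ∀ {n k} → n ℕ.∣ k → k < 2 * n → k ≡ 0 ⊎ k ≡ n
multiple<double (ℕ.divides 0 refl) _ = inj₁ refl
multiple<double {n} (ℕ.divides 1 refl) _ = inj₂ (ℕ.+-identityʳ n)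
multiple<double {n} (ℕ.divides (suc (suc q)) refl) k<2n =
  contradiction k<2n (ℕ.≤⇒≯ (ℕ.+-monoʳ-≤ n (ℕ.+-monoʳ-≤ n z≤n)))

module DicyclicStructure (n : ℕ) .{{_ : NonZero n}} where

  instance
    2n≢0 : NonZero (2 * n)
    2n≢0 = ℕ.m*n≢0 2 n

  open RawMonoid (Dicyclic n) using (Carrier; _∙_; ε)
  open Congruence (2 * n)
  open Exponent (2 * n)

  central : Bool → ℕ
  central b = if b then n else 0

  exponent-∙ : ∀ g h → exponent (g ∙ h) ≋ exponent g + twist (proj₂ g) (exponent h) + + central (proj₂ g ∧ proj₂ h)
  exponent-∙ (i , false) (j , b) = begin
    + toℕ ((toℕ i ℕ.+ toℕ j ℕ.+ 0) mod (2 * n))   ≈⟨ mod-≋ _ ⟩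
    + (toℕ i ℕ.+ toℕ j ℕ.+ 0)                      ≡⟨ trans (ℤ.pos-+ (toℕ i ℕ.+ toℕ j) 0) (cong (_+ + 0) (ℤ.pos-+ (toℕ i) (toℕ j))) ⟩
    + toℕ i + + toℕ j + + 0                        ∎
    where open ≋-Reasoning
  exponent-∙ (i , true) (j , b) = begin
    + toℕ ((toℕ i ℕ.+ (2 * n ℕ.∸ toℕ j) ℕ.+ central b) mod (2 * n))  ≈⟨ mod-≋ _ ⟩
    + (toℕ i ℕ.+ (2 * n ℕ.∸ toℕ j) ℕ.+ central b)                   ≡⟨ trans (ℤ.pos-+ _ (central b)) (cong (_+ + central b) (ℤ.pos-+ (toℕ i) _)) ⟩
    + toℕ i + + (2 * n ℕ.∸ toℕ j) + + central b                     ≈⟨ +-cong (+-cong (≋-refl {+ toℕ i}) (∸-≋ (ℕ.<⇒≤ (Fin.toℕ<n j)))) (≋-refl {+ central b}) ⟩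
    + toℕ i + - + toℕ j + + central b                               ∎
    where open ≋-Reasoning

  module Dₙ = Congruence n
  module Eₙ = Exponent n
  module Dihₙ = DihedralExponents n

  toDihedral : Carrier → Fin n × Bool
  toDihedral (i , a) = (toℕ i mod n , a)

  toDihedral-∙ : ∀ g h → toDihedral (g ∙ h) ≡ dihMul n (toDihedral g) (toDihedral h)
  toDihedral-∙ g@(i , a) h@(j , b) = Eₙ.≋-ext (begin
    + toℕ (toℕ (proj₁ (g ∙ h)) mod n)                          ≈⟨ Dₙ.mod-≋ _ ⟩
    exponent (g ∙ h)                                           ≈⟨ ≋-weaken (ℕ.n∣m*n 2) (exponent-∙ g h) ⟩
    + toℕ i + twist a (+ toℕ j) + + central (a ∧ b)            ≈⟨ Dₙ.+-cong (Dₙ.≋-refl {+ toℕ i + twist a (+ toℕ j)}) (central≋0 (a ∧ b)) ⟩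
    + toℕ i + twist a (+ toℕ j) + 0ℤ                           ≡⟨ ℤ.+-identityʳ _ ⟩
    + toℕ i + twist a (+ toℕ j)                                ≈⟨ Dₙ.+-cong (Dₙ.≋-sym (Dₙ.mod-≋ (toℕ i))) (Dₙ.twist-cong a (Dₙ.≋-sym (Dₙ.mod-≋ (toℕ j)))) ⟩
    Eₙ.exponent (toDihedral g) + twist a (Eₙ.exponent (toDihedral h)) ≈⟨ Dₙ.≋-sym (Dihₙ.exponent-∙ (toDihedral g) (toDihedral h)) ⟩
    Eₙ.exponent (dihMul n (toDihedral g) (toDihedral h))       ∎) refl
    where
    open Dₙ.≋-Reasoning
    central≋0 : ∀ c → + central c Dₙ.≋ 0ℤ
    central≋0 false = Dₙ.≋-refl
    central≋0 true  = Dₙ.m≋0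

  toDihedral-ε : toDihedral ε ≡ RawMonoid.ε (Dihedral n)
  toDihedral-ε = Eₙ.≋-ext
    (Dₙ.≋-trans (Dₙ.mod-≋ _) (Dₙ.≋-trans (≋-weaken (ℕ.n∣m*n 2) (mod-≋ 0)) (Dₙ.≋-sym (Dₙ.mod-≋ 0)))) refl

  toDihedral-prod : ∀ T → toDihedral (prod (Dicyclic n) T) ≡ prod (Dihedral n) (map toDihedral T)
  toDihedral-prod []      = toDihedral-ε
  toDihedral-prod (g ∷ T) = trans (toDihedral-∙ g (prod (Dicyclic n) T)) (cong (dihMul n (toDihedral g)) (toDihedral-prod T))

  z : Carrier
  z = (n mod (2 * n) , false)

  toDihedral-kernel : ∀ g → toDihedral g ≡ RawMonoid.ε (Dihedral n) → g ≡ ε ⊎ g ≡ z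
  toDihedral-kernel (i , false) g↦ε = classify (multiple<double (Dₙ.≋0⇒∣ i≋0) (Fin.toℕ<n i))
    where
    i≋0 : + toℕ i Dₙ.≋ 0ℤ
    i≋0 = Dₙ.≋-trans (Dₙ.≋-sym (Dₙ.mod-≋ (toℕ i))) (Dₙ.≋-trans (Dₙ.≋-reflexive (cong Eₙ.exponent g↦ε)) (Dₙ.mod-≋ 0))
    classify : toℕ i ≡ 0 ⊎ toℕ i ≡ n → (i , false) ≡ ε ⊎ (i , false) ≡ z
    classify (inj₁ i≡0) = inj₁ (≋-ext (≋-trans (≋-reflexive (cong +_ i≡0)) (≋-sym (mod-≋ 0))) refl)
    classify (inj₂ i≡n) = inj₂ (≋-ext (≋-trans (≋-reflexive (cong +_ i≡n)) (≋-sym (mod-≋ n))) refl)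
  toDihedral-kernel (i , true) ()

  +2n≡n+n : + (2 * n) ≡ + n + + n
  +2n≡n+n = cong (λ k → + (n ℕ.+ k)) (ℕ.+-identityʳ n)

  twist-n : ∀ s → twist s (+ n) ≋ + n
  twist-n false = ≋-refl
  twist-n true  = ≋-rearrange (≋-sym m≋0) (trans (regroup (+ n)) (cong (λ k → 0ℤ - k) (sym +2n≡n+n)))
    where
    regroup : ∀ k → - k - k ≡ 0ℤ - (k + k)
    regroup = solve-∀

  exponent-∙z : ∀ h → exponent (h ∙ z) ≋ exponent h + + n
  exponent-∙z h@(j , b) = begin
    exponent (h ∙ z)                                   ≈⟨ exponent-∙ h z ⟩
    + toℕ j + twist b (exponent z) + + central (b ∧ false) ≡⟨ cong (λ c → + toℕ j + twist b (exponent z) + + central c) (Bool.∧-zeroʳ b) ⟩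
    + toℕ j + twist b (exponent z) + 0ℤ                ≡⟨ ℤ.+-identityʳ _ ⟩
    + toℕ j + twist b (exponent z)                     ≈⟨ +-cong (≋-refl {+ toℕ j}) (≋-trans (twist-cong b (mod-≋ n)) (twist-n b)) ⟩
    + toℕ j + + n                                      ∎
    where open ≋-Reasoning

  ∙z-assoc : ∀ g h → g ∙ (h ∙ z) ≡ (g ∙ h) ∙ z
  ∙z-assoc g@(i , a) h@(j , b) = ≋-ext (begin
    exponent (g ∙ (h ∙ z))                                            ≈⟨ exponent-∙ g (h ∙ z) ⟩
    + toℕ i + twist a (exponent (h ∙ z)) + + central (a ∧ (b xor false)) ≡⟨ cong (λ c → + toℕ i + twist a (exponent (h ∙ z)) + + central (a ∧ c)) (Bool.xor-identityʳ b) ⟩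
    + toℕ i + twist a (exponent (h ∙ z)) + + central (a ∧ b)          ≈⟨ +-cong (+-cong (≋-refl {+ toℕ i}) (twist-cong a (exponent-∙z h))) (≋-refl {+ central (a ∧ b)}) ⟩
    + toℕ i + twist a (+ toℕ j + + n) + + central (a ∧ b)             ≡⟨ cong (λ t → + toℕ i + t + + central (a ∧ b)) (twist-+ a (+ toℕ j) (+ n)) ⟩
    + toℕ i + (twist a (+ toℕ j) + twist a (+ n)) + + central (a ∧ b) ≈⟨ +-cong (+-cong (≋-refl {+ toℕ i}) (+-cong (≋-refl {twist a (+ toℕ j)}) (twist-n a))) (≋-refl {+ central (a ∧ b)}) ⟩
    + toℕ i + (twist a (+ toℕ j) + + n) + + central (a ∧ b)           ≡⟨ regroup (+ toℕ i) (twist a (+ toℕ j)) (+ n) (+ central (a ∧ b)) ⟩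
    + toℕ i + twist a (+ toℕ j) + + central (a ∧ b) + + n             ≈⟨ +-cong (≋-sym (exponent-∙ g h)) (≋-refl {+ n}) ⟩
    exponent (g ∙ h) + + n                                            ≈⟨ ≋-sym (exponent-∙z (g ∙ h)) ⟩
    exponent ((g ∙ h) ∙ z)                                            ∎)
    (trans (cong (a xor_) (Bool.xor-identityʳ b)) (sym (Bool.xor-identityʳ (a xor b))))
    where
    open ≋-Reasoning
    regroup : ∀ i t k c → i + (t + k) + c ≡ i + t + c + k
    regroup = solve-∀

  z∙z≡ε : z ∙ z ≡ ε
  z∙z≡ε = ≋-ext (begin
    exponent (z ∙ z)   ≈⟨ exponent-∙z z ⟩
    exponent z + + n   ≈⟨ +-cong (mod-≋ n) (≋-refl {+ n}) ⟩
    + n + + n          ≡⟨ sym +2n≡n+n ⟩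
    + (2 * n)          ≈⟨ m≋0 ⟩
    0ℤ                 ≈⟨ ≋-sym (mod-≋ 0) ⟩
    exponent ε         ∎) refl
    where open ≋-Reasoning

  ε∙z≡z : ε ∙ z ≡ z
  ε∙z≡z = ≋-ext (≋-trans (exponent-∙z ε)
    (≋-trans (≋-rearrange {exponent ε} {0ℤ} {exponent ε + + n} {+ n} (mod-≋ 0) (regroup (exponent ε) (+ n)))
             (≋-sym (mod-≋ n)))) refl
    where
    regroup : ∀ e k → (e + k) - k ≡ e - 0ℤ
    regroup = solve-∀

  foldr-z : ∀ A → foldr _∙_ z A ≡ prod (Dicyclic n) A ∙ z
  foldr-z []      = sym ε∙z≡z
  foldr-z (g ∷ A) = trans (cong (g ∙_) (foldr-z A)) (∙z-assoc g (prod (Dicyclic n) A))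

  prod-++-z : ∀ A B → prod (Dicyclic n) A ≡ z → prod (Dicyclic n) B ≡ z → prod (Dicyclic n) (A ++ B) ≡ ε
  prod-++-z A B A≡z B≡z = begin
    prod (Dicyclic n) (A ++ B)           ≡⟨ List.foldr-++ _∙_ ε A B ⟩
    foldr _∙_ (prod (Dicyclic n) B) A    ≡⟨ cong (λ b → foldr _∙_ b A) B≡z ⟩
    foldr _∙_ z A                        ≡⟨ foldr-z A ⟩
    prod (Dicyclic n) A ∙ z              ≡⟨ cong (_∙ z) A≡z ⟩
    z ∙ z                                ≡⟨ z∙z≡ε ⟩
    ε                                    ∎
    where open ≡-Reasoning

  open ZeroSumInvariants _∙_ ε using (ShortProductOne)

  module _ (3≤n : 3 ≤ n) where

    open Dihₙ.Words toDihedral using (ShortImageProductOne) renaming (dihedral-short-product-one to dihedral-image)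

    ShortKernelProduct : List Carrier → Set
    ShortKernelProduct S = ∃ λ T → T ⊑ S × 1 ≤ length T × length T ≤ n ×
                           (prod (Dicyclic n) T ≡ ε ⊎ prod (Dicyclic n) T ≡ z)

    short-in-kernel : ∀ S → suc n ≤ length S → ShortKernelProduct S
    short-in-kernel S 1+n≤|S| = lift (dihedral-image 3≤n (take (suc n) S) |take|)
      where
      |take| : length (take (suc n) S) ≡ suc n
      |take| = trans (List.length-take (suc n) S) (ℕ.m≤n⇒m⊓n≡m 1+n≤|S|)
      lift : ShortImageProductOne n (take (suc n) S) → ShortKernelProduct S
      lift (T , T⊑ , 1≤|T| , |T|≤n , T↦ε) =
        T , ⊑-trans T⊑ (⊆⇒⊑ (Sublist.take-⊆ (suc n) S)) , 1≤|T| , |T|≤n ,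
        toDihedral-kernel (prod (Dicyclic n) T) (trans (toDihedral-prod T) T↦ε)

    dicyclic-short-product-one : ∀ S → length S ≡ suc (2 * n) → ShortProductOne (2 * n) S
    dicyclic-short-product-one S |S|≡1+2n = second (short-in-kernel S 1+n≤|S|)
      where
      n≤2n : n ≤ 2 * n
      n≤2n = ℕ.m≤m+n n (n ℕ.+ 0)
      1+n≤|S| : suc n ≤ length S
      1+n≤|S| = subst (suc n ≤_) (sym |S|≡1+2n) (s≤s n≤2n)
      1+2n≡n+1+n : suc (2 * n) ≡ n ℕ.+ suc n
      1+2n≡n+1+n = trans (cong (λ k → suc (n ℕ.+ k)) (ℕ.+-identityʳ n)) (sym (ℕ.+-suc n n))
      second : ShortKernelProduct S → ShortProductOne (2 * n) S
      second (T₁ , (R , S↭T₁++R) , 1≤|T₁| , |T₁|≤n , T₁-kernel) =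
        combine T₁-kernel (short-in-kernel R 1+n≤|R|)
        where
        |T₁|+|R| : length T₁ ℕ.+ length R ≡ n ℕ.+ suc n
        |T₁|+|R| = trans (sym (List.length-++ T₁)) (trans (sym (Perm.↭-length S↭T₁++R)) (trans |S|≡1+2n 1+2n≡n+1+n))
        1+n≤|R| : suc n ≤ length R
        1+n≤|R| = ℕ.+-cancelˡ-≤ n (suc n) (length R)
                    (subst (_≤ n ℕ.+ length R) |T₁|+|R| (ℕ.+-monoˡ-≤ (length R) |T₁|≤n))
        R⊑S : R ⊑ S
        R⊑S = T₁ , ↭-trans S↭T₁++R (Perm.++-comm T₁ R)
        combine : prod (Dicyclic n) T₁ ≡ ε ⊎ prod (Dicyclic n) T₁ ≡ z → ShortKernelProduct R → ShortProductOne (2 * n) S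
        combine (inj₁ T₁≡ε) _ = T₁ , (R , S↭T₁++R) , 1≤|T₁| , ℕ.≤-trans |T₁|≤n n≤2n , T₁≡ε
        combine (inj₂ _) (T₂ , T₂⊑R , 1≤|T₂| , |T₂|≤n , inj₁ T₂≡ε) =
          T₂ , ⊑-trans T₂⊑R R⊑S , 1≤|T₂| , ℕ.≤-trans |T₂|≤n n≤2n , T₂≡ε
        combine (inj₂ T₁≡z) (T₂ , T₂⊑R , 1≤|T₂| , |T₂|≤n , inj₂ T₂≡z) =
          T₁ ++ T₂ , ⊑-trans (⊑-++⁺ (↭⇒⊑ ↭-refl) T₂⊑R) (↭⇒⊑ (↭-sym S↭T₁++R)) ,
          subst (1 ≤_) (sym (List.length-++ T₁)) (ℕ.≤-trans 1≤|T₁| (ℕ.m≤m+n _ _)) ,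
          subst (_≤ 2 * n) (sym (List.length-++ T₁)) (ℕ.+-mono-≤ |T₁|≤n (subst (length T₂ ≤_) (sym (ℕ.+-identityʳ n)) |T₂|≤n)) ,
          prod-++-z T₁ T₂ T₁≡z T₂≡z

  rotation-∙ : ∀ h → exponent ((1 mod (2 * n) , false) ∙ h) ≋ + 1 + exponent h × proj₂ ((1 mod (2 * n) , false) ∙ h) ≡ proj₂ h
  rotation-∙ h = ≋-trans (exponent-∙ (1 mod (2 * n) , false) h)
    (≋-trans (≋-reflexive (ℤ.+-identityʳ _)) (+-cong (mod-≋ 1) (≋-refl {exponent h}))) , refl

-- The dihedral lemma needs n ≥ 3 (in D₄ the sequence x, y, xy has no product-one
-- subsequence of length ≤ 2), so Q₈ is settled by checking all 8⁵ sequences.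
module Quaternion where

  open RawMonoid (Dicyclic 2) using (Carrier; _∙_; ε)
  open ZeroSumInvariants _∙_ ε using (ShortProductOne)

  Selection : ℕ → List Carrier → Set
  Selection k L = ∃ λ T → T ⊑ L × length T ≡ k

  picks : (L : List Carrier) → List (∃₂ λ a R → L ↭ a ∷ R)
  picks []      = []
  picks (a ∷ L) = (a , L , ↭-refl) ∷ map moved (picks L)
    where
    moved : (∃₂ λ b R → L ↭ b ∷ R) → ∃₂ λ b R → a ∷ L ↭ b ∷ R
    moved (b , R , L↭bR) = b , a ∷ R , ↭-trans (prep a L↭bR) (swap a b ↭-refl)

  selections : ∀ k L → List (Selection k L)
  selections zero    L = ([] , (L , ↭-refl) , refl) ∷ []
  selections (suc k) L = concatMap extend (picks L)
    where
    extend : (∃₂ λ a R → L ↭ a ∷ R) → List (Selection (suc k) L)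
    extend (a , R , L↭aR) = map prepend (selections k R)
      where
      prepend : Selection k R → Selection (suc k) L
      prepend (T , (C , R↭T++C) , |T|≡k) = a ∷ T , (C , ↭-trans L↭aR (prep a R↭T++C)) , cong suc |T|≡k

  first-product-one : ∀ {k L} → 1 ≤ k → k ≤ 4 → List (Selection k L) → Maybe (ShortProductOne 4 L)
  first-product-one _ _ [] = nothing
  first-product-one {k} 1≤k k≤4 ((T , T⊑L , |T|≡k) ∷ rest) with ≡-dec Fin._≟_ Bool._≟_ (prod (Dicyclic 2) T) ε
  ... | yes T≡ε = just (T , T⊑L , subst (1 ≤_) (sym |T|≡k) 1≤k , subst (_≤ 4) (sym |T|≡k) k≤4 , T≡ε)
  ... | no  _   = first-product-one 1≤k k≤4 rest

  search : ∀ L → Maybe (ShortProductOne 4 L)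
  search L = first-product-one {1} (s≤s z≤n) (s≤s z≤n) (selections 1 L)
         <∣> first-product-one {2} (s≤s z≤n) (s≤s (s≤s z≤n)) (selections 2 L)
         <∣> first-product-one {3} (s≤s z≤n) (s≤s (s≤s (s≤s z≤n))) (selections 3 L)
         <∣> first-product-one {4} (s≤s z≤n) ℕ.≤-refl (selections 4 L)

  from-is-just : ∀ {X : Set} (m : Maybe X) → Bool.T (is-just m) → X
  from-is-just (just x) _ = x

  elements : List Carrier
  elements = cartesianProduct (allFin 4) (false ∷ true ∷ [])

  ∈-elements : ∀ g → g ∈ elements
  ∈-elements (i , false) = ∈-cartesianProduct⁺ {xs = allFin 4} {ys = false ∷ true ∷ []} (∈-allFin i) (here refl)
  ∈-elements (i , true)  = ∈-cartesianProduct⁺ {xs = allFin 4} {ys = false ∷ true ∷ []} (∈-allFin i) (there (here refl))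

  covered : ℕ → List Carrier → Bool
  covered zero    L = is-just (search L)
  covered (suc k) L = is-just (search L) ∨ all (λ g → covered k (L ++ g ∷ [])) elements

  covered-sound : ∀ k L → Bool.T (covered k L) → ∀ E → length E ≡ k → ShortProductOne 4 (L ++ E)
  covered-sound zero L L-found [] _ = subst (ShortProductOne 4) (sym (List.++-identityʳ L)) (from-is-just (search L) L-found)
  covered-sound (suc k) L covered-L E |E|≡1+k with Equivalence.to Bool.T-∨ covered-L
  ... | inj₁ L-found = extend (from-is-just (search L) L-found)
    where
    extend : ShortProductOne 4 L → ShortProductOne 4 (L ++ E)
    extend (T , T⊑L , bounds) = T , ⊑-trans T⊑L (⊆⇒⊑ (Sublist.++⁺ʳ E ⊆-refl)) , bounds
  covered-sound (suc k) L _ (g ∷ E) |E|≡1+k | inj₂ extensions-covered =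
    subst (ShortProductOne 4) (List.++-assoc L (g ∷ []) E)
      (covered-sound k (L ++ g ∷ []) (All.lookup (All.all⁺ (λ h → covered k (L ++ h ∷ [])) elements extensions-covered) (∈-elements g)) E (ℕ.suc-injective |E|≡1+k))

  all-covered : covered 5 [] ≡ true
  all-covered = refl

  quaternion-short-product-one : ∀ S → length S ≡ 5 → ShortProductOne 4 S
  quaternion-short-product-one = covered-sound 5 [] (subst Bool.T (sym all-covered) _)

dihedral-invariants : (n : ℕ) .{{_ : NonZero n}} → 3 ≤ n →
  FIs (Dihedral n) n × EIs (Dihedral n) n × DavenportIs (Dihedral n) (suc n)
dihedral-invariants n 3≤n =
  invariants proj₂ (λ _ _ → refl) refl n (ℕ.≤-trans (s≤s z≤n) 3≤n) short-product-one
    x (0 mod n , true) refl refl (x^M≡ε rotation-∙) (x^m≢ε rotation-∙)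
  where
  open ZeroSumInvariants (dihMul n) (0 mod n , false)
  open RotationPowers n (dihMul n)
  open DihedralExponents n using (rotation-∙; module Words)
  open Words (λ g → g) using (dihedral-short-product-one)
  short-product-one : ∀ S → length S ≡ suc n → ShortProductOne n S
  short-product-one S |S|≡1+n with dihedral-short-product-one 3≤n S |S|≡1+n
  ... | T , T⊑S , 1≤|T| , |T|≤n , T≡ε = T , T⊑S , 1≤|T| , |T|≤n , subst (λ U → prod (Dihedral n) U ≡ _) (List.map-id T) T≡ε

dicyclic-invariants : (n : ℕ) .{{_ : NonZero n}} →
  (∀ S → length S ≡ suc (2 * n) → ZeroSumInvariants.ShortProductOne (dicMul n) (RawMonoid.ε (Dicyclic n)) (2 * n) S) →
  FIs (Dicyclic n) (2 * n) × EIs (Dicyclic n) (2 * n) × DavenportIs (Dicyclic n) (suc (2 * n))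
dicyclic-invariants n short-product-one =
  invariants proj₂ (λ _ _ → refl) refl (2 * n) (ℕ.≤-trans (ℕ.>-nonZero⁻¹ n) (ℕ.m≤m+n n (n ℕ.+ 0))) short-product-one
    x (0 mod (2 * n) , true) refl refl (x^M≡ε rotation-∙) (x^m≢ε rotation-∙)
  where
  open DicyclicStructure n using (2n≢0; rotation-∙)
  open ZeroSumInvariants (dicMul n) (RawMonoid.ε (Dicyclic n))
  open RotationPowers (2 * n) (dicMul n)

theorem1p3 : ((n : ℕ) .{{_ : NonZero n}} → 3 ≤ n →
       FIs (Dihedral n) n × EIs (Dihedral n) n × DavenportIs (Dihedral n) (suc n))
    ×
    ((n : ℕ) .{{_ : NonZero n}} → 2 ≤ n →
       FIs (Dicyclic n) (2 * n) × EIs (Dicyclic n) (2 * n)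
         × DavenportIs (Dicyclic n) (suc (2 * n)))
theorem1p3 = dihedral-invariants , dicyclic
  where
  dicyclic : (n : ℕ) .{{_ : NonZero n}} → 2 ≤ n →
    FIs (Dicyclic n) (2 * n) × EIs (Dicyclic n) (2 * n) × DavenportIs (Dicyclic n) (suc (2 * n))
  dicyclic 1 (s≤s ())
  dicyclic 2 _ = dicyclic-invariants 2 Quaternion.quaternion-short-product-one
  dicyclic n@(suc (suc (suc _))) _ =
    dicyclic-invariants n (DicyclicStructure.dicyclic-short-product-one n (s≤s (s≤s (s≤s z≤n))))
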